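{- Let $k\geq 1$, $n=8k+7$, $G=C(n,\pm\{1,2,3,4\})$, and $m'\in\{1,\dots,k\}$. Let $A_i=\{3+4i,4+4i\}$ for $0\leq i\leq k-1$, $A_k=\{3+4k,4+4k,5+4k\}$, $B_1=\{3+4(k+m'),4+4(k+m')\}$, $B_2=\{5+4(k+m'),6+4(k+m')\}$ (indices mod $n$), and suppose $A=(A_0,A_1,\dots,A_k,B_1,B_2)$ is an $S$-cluster for some $S\subseteq V(G)$. If $X\subseteq V(G)$ resolves $A$, then $|X|\geq 3$.
   Context: $C(n,\pm\{1,2,3,4\})$ is the graph on $\mathbb{Z}_n$ where distinct $i,j$ are adjacent iff $j-i\equiv\pm s\pmod n$ for some $s\in\{1,2,3,4\}$; $d$ is graph distance, and $r(v|X)=(d(v,x))_{x\in X}$. For $S\subseteq V$, a set $B$ is an $S$-block if $r(a|S)=r(b|S)$ for all $a,b\in B$. A tuple $(A_1,\dots,A_p)$ of $S$-blocks is an $S$-cluster if the $A_i$ are contained in distinct equivalence classes of $u\sim_S v\iff r(u|S)=r(v|S)$. A set $X$ resolves a tuple $(A_1,\dots,A_p)$ if $r(a|X)\neq r(b|X)$ for all distinct $a,b$ in the same $A_j$. -}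

module Defs where

open import Data.Bool using (Bool; true; false; if_then_else_; not; _∧_; _∨_)
open import Data.Nat using (ℕ; zero; suc; _+_; _*_; _≡ᵇ_; _<ᵇ_; NonZero)
open import Data.Nat.DivMod using (_%_; _mod_)
open import Data.Fin using (Fin; toℕ)
open import Data.Fin.Subset as Sub using (Subset)
open import Data.List using (List; []; _∷_; allFin)
open import Data.Bool.ListAction using (any)
open import Data.List.Membership.Propositional using () renaming (_∈_ to _∈ᴸ_)
open import Relation.Binary.PropositionalEquality using (_≡_; _≢_)
open import Relation.Nullary using (¬_)
open import Data.Product using (_×_)

module Circulant (n : ℕ) .{{_ : NonZero n}} where

  adjᵇ : Fin n → Fin n → Bool
  adjᵇ i j = not (toℕ i ≡ᵇ toℕ j) ∧
    any (λ s → ((toℕ j ≡ᵇ (toℕ i + s) % n)) ∨ (toℕ i ≡ᵇ (toℕ j + s) % n))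
        (1 ∷ 2 ∷ 3 ∷ 4 ∷ [])

  reach : ℕ → Fin n → Fin n → Bool
  reach zero    u v = toℕ u ≡ᵇ toℕ v
  reach (suc m) u v = reach m u v ∨ any (λ w → reach m u w ∧ adjᵇ w v) (allFin n)

  firstFrom : ℕ → ℕ → (ℕ → Bool) → ℕ
  firstFrom zero       cur f = cur
  firstFrom (suc fuel) cur f = if f cur then cur else firstFrom fuel (suc cur) f

  -- graph distance d(u,v): least m with a walk of length ≤ m from u to v
  -- (any finite distance is < n, so searching m ∈ [0, n) suffices)
  dist : Fin n → Fin n → ℕ
  dist u v = firstFrom n 0 (λ m → reach m u v)

  V : Set
  V = Fin n

  SameRep : Subset n → V → V → Set
  SameRep X a b = ∀ x → x Sub.∈ X → dist a x ≡ dist b x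

  IsBlock : Subset n → List V → Set
  IsBlock S B = ∀ a b → a ∈ᴸ B → b ∈ᴸ B → SameRep S a b

  IsCluster : Subset n → (p : ℕ) → (Fin p → List V) → Set
  IsCluster S p A =
    (∀ i → IsBlock S (A i)) ×
    (∀ i j → i ≢ j → ∀ a b → a ∈ᴸ A i → b ∈ᴸ A j → ¬ SameRep S a b)

  Resolves : Subset n → (p : ℕ) → (Fin p → List V) → Set
  Resolves X p A = ∀ j a b → a ∈ᴸ A j → b ∈ᴸ A j → a ≢ b → ¬ SameRep X a b

N : ℕ → ℕ
N k = 7 + 8 * k

vtx : (k : ℕ) → ℕ → Fin (N k)
vtx k a = a mod (N k)

-- the tuple A = (A_0, …, A_k, B_1, B_2), indexed by t ∈ Fin (k + 3):
--   t < k : A_t = {3+4t, 4+4t};  t = k : A_k = {3+4k, 4+4k, 5+4k};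
--   t = k+1 : B_1 = {3+4(k+m'), 4+4(k+m')};  t = k+2 : B_2 = {5+4(k+m'), 6+4(k+m')}
clusterA : (k m' : ℕ) → Fin (k + 3) → List (Fin (N k))
clusterA k m' t =
  if toℕ t <ᵇ k then vtx k (3 + 4 * toℕ t) ∷ vtx k (4 + 4 * toℕ t) ∷ []
  else if toℕ t ≡ᵇ k then vtx k (3 + 4 * k) ∷ vtx k (4 + 4 * k) ∷ vtx k (5 + 4 * k) ∷ []
  else if toℕ t ≡ᵇ suc k then vtx k (3 + 4 * (k + m')) ∷ vtx k (4 + 4 * (k + m')) ∷ []
  else vtx k (5 + 4 * (k + m')) ∷ vtx k (6 + 4 * (k + m')) ∷ []

-- In C(n, ±{1,2,3,4}) the distance between u and v is ⌈c/4⌉, where c is their distance along the cycle ℤ_n.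
-- For n = 8k+7 it follows that a vertex x can distinguish consecutive vertices u and u + 1 only if x lies
-- 1 + 4j steps ahead of u or 4j steps behind u for some j ≤ k. A set resolving A must distinguish the pairs
-- {3,4} ⊆ A₀, {4+4k,5+4k} ⊆ Aₖ, {3+4(k+m'),4+4(k+m')} = B₁ and {5+4(k+m'),6+4(k+m')} = B₂. Sorting the
-- candidate vertices by residue and quotient modulo 4 shows that a vertex distinguishing the B₁ pair
-- distinguishes none of the other three, and that no vertex distinguishes the pairs of A₀, Aₖ and B₂ at once;
-- so X contains at least three vertices.
module Submission where

open import Data.Bool using (Bool; true; false; T; not; _∨_; if_then_else_)
open import Data.Bool.Properties using (T-∨; T-∧)
open import Data.Empty using (⊥; ⊥-elim)
open import Data.Fin using (Fin; zero; suc; toℕ; _↑ʳ_) renaming (_≟_ to _≟ᶠ_)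
open import Data.Fin.Properties using (toℕ-fromℕ<; toℕ<n; toℕ-↑ʳ; toℕ-injective; ¬∀⟶∃¬)
open import Data.Fin.Subset as Subset using (Subset; ∣_∣; _-_)
open import Data.Fin.Subset.Properties using (_∈?_; x∈p⇒∣p-x∣<∣p∣; x∈p∧x≢y⇒x∈p-y)
open import Data.List using (List; []; _∷_; allFin)
open import Data.List.Membership.Propositional using (_∈_; lose)
open import Data.List.Membership.Propositional.Properties using (∈-allFin)
open import Data.List.Relation.Unary.All using (All; []; _∷_; lookupAny)
open import Data.List.Relation.Unary.Any using (here; there; satisfied)
open import Data.List.Relation.Unary.Any.Properties using (any⁺; any⁻)
open import Data.Nat hiding (∣_-_∣)
open import Data.Nat.DivMod
open import Data.Nat.Properties
open import Data.Nat.Tactic.RingSolver using (solve-∀)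
open import Algebra.Properties.CommutativeSemigroup +-commutativeSemigroup using (x∙yz≈y∙xz)
open import Data.Product using (∃-syntax; _×_; _,_; proj₁; proj₂)
open import Data.Sum using (_⊎_; inj₁; inj₂)
open import Data.Unit using (⊤; tt)
open import Function using (_∘_; Equivalence)
open import Relation.Binary.PropositionalEquality
open import Relation.Binary.Definitions using (tri<; tri≈; tri>)
open import Relation.Nullary using (¬_; Dec; yes; no)

open import Defs

open Equivalence using (to; from)

T-not-≡ᵇ : ∀ {a b} → a ≢ b → T (not (a ≡ᵇ b))
T-not-≡ᵇ {a} {b} a≢b with a ≡ᵇ b in a≡ᵇb
... | true  = ⊥-elim (a≢b (≡ᵇ⇒≡ a b (subst T (sym a≡ᵇb) _)))
... | false = _

toℕ-mod : ∀ a n .{{_ : NonZero n}} → toℕ (a mod n) ≡ a % n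
toℕ-mod a n = toℕ-fromℕ< (m%n<n a n)

⌈_/4⌉ : ℕ → ℕ
⌈ zero /4⌉                      = 0
⌈ suc zero /4⌉                  = 1
⌈ suc (suc zero) /4⌉            = 1
⌈ suc (suc (suc zero)) /4⌉      = 1
⌈ suc (suc (suc (suc m))) /4⌉   = suc ⌈ m /4⌉

⌈m/4⌉≤m : ∀ m → ⌈ m /4⌉ ≤ m
⌈m/4⌉≤m zero                      = z≤n
⌈m/4⌉≤m (suc zero)                = ≤-refl
⌈m/4⌉≤m (suc (suc zero))          = s≤s z≤n
⌈m/4⌉≤m (suc (suc (suc zero)))    = s≤s z≤n
⌈m/4⌉≤m (suc (suc (suc (suc m)))) = s≤s (m≤n⇒m≤o+n 3 (⌈m/4⌉≤m m))

m≤4*n⇒⌈m/4⌉≤n : ∀ m n → m ≤ 4 * n → ⌈ m /4⌉ ≤ n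
m≤4*n⇒⌈m/4⌉≤n zero                      n       _ = z≤n
m≤4*n⇒⌈m/4⌉≤n (suc zero)                (suc n) _ = s≤s z≤n
m≤4*n⇒⌈m/4⌉≤n (suc (suc zero))          (suc n) _ = s≤s z≤n
m≤4*n⇒⌈m/4⌉≤n (suc (suc (suc zero)))    (suc n) _ = s≤s z≤n
m≤4*n⇒⌈m/4⌉≤n (suc (suc (suc (suc m)))) (suc n) m≤4+4n
  rewrite *-suc 4 n = s≤s (m≤4*n⇒⌈m/4⌉≤n m n (s≤s⁻¹ (s≤s⁻¹ (s≤s⁻¹ (s≤s⁻¹ m≤4+4n)))))
m≤4*n⇒⌈m/4⌉≤n (suc m) zero ()

⌈m/4⌉≤n⇒m≤4*n : ∀ m n → ⌈ m /4⌉ ≤ n → m ≤ 4 * n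
⌈m/4⌉≤n⇒m≤4*n zero                      _       _ = z≤n
⌈m/4⌉≤n⇒m≤4*n (suc zero)                (suc n) _ = ≤-trans (s≤s z≤n) (m≤m*n 4 (suc n))
⌈m/4⌉≤n⇒m≤4*n (suc (suc zero))          (suc n) _ = ≤-trans (s≤s (s≤s z≤n)) (m≤m*n 4 (suc n))
⌈m/4⌉≤n⇒m≤4*n (suc (suc (suc zero)))    (suc n) _ = ≤-trans (s≤s (s≤s (s≤s z≤n))) (m≤m*n 4 (suc n))
⌈m/4⌉≤n⇒m≤4*n (suc (suc (suc (suc m)))) (suc n) (s≤s ⌈m/4⌉≤n)
  rewrite *-suc 4 n = s≤s (s≤s (s≤s (s≤s (⌈m/4⌉≤n⇒m≤4*n m n ⌈m/4⌉≤n))))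

4*m<c≤4*[1+m]⇒4*m+s≡c : ∀ m {c} → 4 * m < c → c ≤ 4 * suc m → ∃[ s ] 1 ≤ s × s ≤ 4 × 4 * m + s ≡ c
4*m<c≤4*[1+m]⇒4*m+s≡c m {c} 4m<c c≤4+4m = c ∸ 4 * m , m<n⇒0<n∸m 4m<c , s≤4 , m+[n∸m]≡n (<⇒≤ 4m<c)
  where
  s≤4 : c ∸ 4 * m ≤ 4
  s≤4 = subst (c ∸ 4 * m ≤_) (trans (cong (_∸ 4 * m) (*-suc 4 m)) (m+n∸n≡m 4 (4 * m))) (∸-monoˡ-≤ (4 * m) c≤4+4m)

⌈m/4⌉≢⌈1+m/4⌉⇒m≡4*j : ∀ m → ⌈ m /4⌉ ≢ ⌈ suc m /4⌉ → ∃[ j ] m ≡ 4 * j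
⌈m/4⌉≢⌈1+m/4⌉⇒m≡4*j zero                      _ = 0 , refl
⌈m/4⌉≢⌈1+m/4⌉⇒m≡4*j (suc zero)                ≢ = ⊥-elim (≢ refl)
⌈m/4⌉≢⌈1+m/4⌉⇒m≡4*j (suc (suc zero))          ≢ = ⊥-elim (≢ refl)
⌈m/4⌉≢⌈1+m/4⌉⇒m≡4*j (suc (suc (suc zero)))    ≢ = ⊥-elim (≢ refl)
⌈m/4⌉≢⌈1+m/4⌉⇒m≡4*j (suc (suc (suc (suc m)))) ≢
  with j , m≡4j ← ⌈m/4⌉≢⌈1+m/4⌉⇒m≡4*j m (≢ ∘ cong suc)
  = suc j , trans (cong (4 +_) m≡4j) (sym (*-suc 4 j))

4*j<3+4*k⇒j≤k : ∀ {j k} → 4 * j < 3 + 4 * k → j ≤ k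
4*j<3+4*k⇒j≤k {j} {k} 4j<3+4k = s≤s⁻¹ (*-cancelˡ-< 4 j (suc k) (<-≤-trans 4j<3+4k 3+4*k≤4*[1+k]))
  where
  3+4*k≤4*[1+k] : 3 + 4 * k ≤ 4 * suc k
  3+4*k≤4*[1+k] = subst (3 + 4 * k ≤_) (sym (*-suc 4 k)) (n≤1+n (3 + 4 * k))

⌈1+t⊓a/4⌉≢⌈t⊓1+a/4⌉⇒4∣t : ∀ k {t a} → t < a → t + a ≡ 6 + 8 * k →
                             ⌈ suc t ⊓ a /4⌉ ≢ ⌈ t ⊓ suc a /4⌉ → ∃[ j ] j ≤ k × t ≡ 4 * j
⌈1+t⊓a/4⌉≢⌈t⊓1+a/4⌉⇒4∣t k {t} {a} t<a t+a≡6+8k ⌈⌉≢⌈⌉ =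
  let j , t≡4j = ⌈m/4⌉≢⌈1+m/4⌉⇒m≡4*j t (⌈⌉≢⌈⌉ ∘ mins)
  in  j , 4*j<3+4*k⇒j≤k (subst (_< 3 + 4 * k) t≡4j t<3+4k) , t≡4j
  where
  mins : ⌈ t /4⌉ ≡ ⌈ suc t /4⌉ → ⌈ suc t ⊓ a /4⌉ ≡ ⌈ t ⊓ suc a /4⌉
  mins e = trans (cong ⌈_/4⌉ (m≤n⇒m⊓n≡m t<a))
                 (trans (sym e) (cong ⌈_/4⌉ (sym (m≤n⇒m⊓n≡m (≤-trans (n≤1+n t) (<⇒≤ (s≤s t<a)))))))
  t<3+4k : t < 3 + 4 * k
  t<3+4k with t <? 3 + 4 * k
  ... | yes t<3+4k = t<3+4k
  ... | no  t≮3+4k = ⊥-elim (<-irrefl (sym t+a≡6+8k) (begin-strict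
    6 + 8 * k                   ≡⟨ 6+8*k≡[3+4*k]+[3+4*k] k ⟩
    3 + 4 * k + (3 + 4 * k)     <⟨ +-mono-≤-< (≮⇒≥ t≮3+4k) (≤-<-trans (≮⇒≥ t≮3+4k) t<a) ⟩
    t + a                       ∎))
    where
    open ≤-Reasoning
    6+8*k≡[3+4*k]+[3+4*k] : ∀ k → 6 + 8 * k ≡ 3 + 4 * k + (3 + 4 * k)
    6+8*k≡[3+4*k]+[3+4*k] = solve-∀

-- If 1 + t and a are the two arcs from u to x, then t and 1 + a are the arcs from u + 1 to x.
⌈1+t⊓a/4⌉≢⌈t⊓1+a/4⌉⇒4∣t⊎4∣a : ∀ k {t a} → t + a ≡ 6 + 8 * k → ⌈ suc t ⊓ a /4⌉ ≢ ⌈ t ⊓ suc a /4⌉ →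
                               (∃[ j ] j ≤ k × t ≡ 4 * j) ⊎ (∃[ j ] j ≤ k × a ≡ 4 * j)
⌈1+t⊓a/4⌉≢⌈t⊓1+a/4⌉⇒4∣t⊎4∣a k {t} {a} t+a≡6+8k ⌈⌉≢⌈⌉ with <-cmp t a
... | tri< t<a _ _ = inj₁ (⌈1+t⊓a/4⌉≢⌈t⊓1+a/4⌉⇒4∣t k t<a t+a≡6+8k ⌈⌉≢⌈⌉)
... | tri≈ _ refl _ = ⊥-elim (⌈⌉≢⌈⌉ (cong ⌈_/4⌉ (trans (m≥n⇒m⊓n≡n (n≤1+n t)) (sym (m≤n⇒m⊓n≡m (n≤1+n t))))))
... | tri> _ _ a<t = inj₂ (⌈1+t⊓a/4⌉≢⌈t⊓1+a/4⌉⇒4∣t k a<t (trans (+-comm a t) t+a≡6+8k) (⌈⌉≢⌈⌉ ∘ swap))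
  where
  swap : ⌈ suc a ⊓ t /4⌉ ≡ ⌈ a ⊓ suc t /4⌉ → ⌈ suc t ⊓ a /4⌉ ≡ ⌈ t ⊓ suc a /4⌉
  swap e = trans (cong ⌈_/4⌉ (⊓-comm (suc t) a)) (trans (sym e) (cong ⌈_/4⌉ (⊓-comm (suc a) t)))

[4*q+r]%4≡r : ∀ q {r} → r < 4 → (4 * q + r) % 4 ≡ r
[4*q+r]%4≡r q {r} r<4 = begin
  (4 * q + r) % 4   ≡⟨ cong (_% 4) (trans (+-comm (4 * q) r) (cong (r +_) (*-comm 4 q))) ⟩
  (r + q * 4) % 4   ≡⟨ [m+kn]%n≡m%n r q 4 ⟩
  r % 4             ≡⟨ m<n⇒m%n≡m r<4 ⟩
  r                 ∎
  where open ≡-Reasoning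

4*q+r≡4*q′+r′⇒r≡r′×q≡q′ : ∀ q q′ {r r′} → r < 4 → r′ < 4 → 4 * q + r ≡ 4 * q′ + r′ → r ≡ r′ × q ≡ q′
4*q+r≡4*q′+r′⇒r≡r′×q≡q′ q q′ {r} {r′} r<4 r′<4 eq =
  r≡r′ , *-cancelˡ-≡ q q′ 4 (+-cancelʳ-≡ r (4 * q) (4 * q′) (trans eq (cong (4 * q′ +_) (sym r≡r′))))
  where
  r≡r′ : r ≡ r′
  r≡r′ = trans (sym ([4*q+r]%4≡r q r<4)) (trans (cong (_% 4) eq) ([4*q+r]%4≡r q′ r′<4))

4*q+[r+3]≡4*q′+r′⇒r≡1+r′×q′≡1+q : ∀ q q′ {r r′} → r < 4 → r′ < 3 → 4 * q + (r + 3) ≡ 4 * q′ + r′ →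
                                   r ≡ suc r′ × q′ ≡ suc q
4*q+[r+3]≡4*q′+r′⇒r≡1+r′×q′≡1+q q q′ {zero} {r′} _ r′<3 eq =
  ⊥-elim (<-irrefl (sym (proj₁ (4*q+r≡4*q′+r′⇒r≡r′×q≡q′ q q′ ≤-refl (m<n⇒m<1+n r′<3) eq))) r′<3)
4*q+[r+3]≡4*q′+r′⇒r≡1+r′×q′≡1+q q q′ {suc r} {r′} (s≤s r<3) r′<3 eq =
  let r≡r′ , 1+q≡q′ = 4*q+r≡4*q′+r′⇒r≡r′×q≡q′ (suc q) q′ (m<n⇒m<1+n r<3) (m<n⇒m<1+n r′<3)
                         (trans (4*[1+q]+r≡4*q+[1+r+3] q r) eq)
  in  cong suc r≡r′ , sym 1+q≡q′
  where
  4*[1+q]+r≡4*q+[1+r+3] : ∀ q r → 4 * suc q + r ≡ 4 * q + (suc r + 3)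
  4*[1+q]+r≡4*q+[1+r+3] = solve-∀

4*[i+2*k+1]+[r+3]≡4*i+r+n : ∀ k i r → 4 * (i + 2 * k + 1) + (r + 3) ≡ 4 * i + r + (7 + 8 * k)
4*[i+2*k+1]+[r+3]≡4*i+r+n = solve-∀

4*[1+k+m+j]≡3+4*[k+m]+[1+4*j] : ∀ k m j → 4 * suc (k + m + j) + 0 ≡ 3 + 4 * (k + m) + suc (4 * j)
4*[1+k+m+j]≡3+4*[k+m]+[1+4*j] = solve-∀

4*[1+k+m+j]+2≡5+4*[k+m]+[1+4*j] : ∀ k m j → 4 * suc (k + m + j) + 2 ≡ 5 + 4 * (k + m) + suc (4 * j)
4*[1+k+m+j]+2≡5+4*[k+m]+[1+4*j] = solve-∀

module Offsets (n : ℕ) .{{_ : NonZero n}} where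
  open ≡-Reasoning

  [m%n+o]%n≡[m+o]%n : ∀ m o → (m % n + o) % n ≡ (m + o) % n
  [m%n+o]%n≡[m+o]%n m o = begin
    (m % n + o) % n           ≡⟨ %-distribˡ-+ (m % n) o n ⟩
    (m % n % n + o % n) % n   ≡⟨ cong (λ z → (z + o % n) % n) (m%n%n≡m%n m n) ⟩
    (m % n + o % n) % n       ≡⟨ %-distribˡ-+ m o n ⟨
    (m + o) % n               ∎

  [m+o%n]%n≡[m+o]%n : ∀ m o → (m + o % n) % n ≡ (m + o) % n
  [m+o%n]%n≡[m+o]%n m o = begin
    (m + o % n) % n   ≡⟨ cong (_% n) (+-comm m (o % n)) ⟩
    (o % n + m) % n   ≡⟨ [m%n+o]%n≡[m+o]%n o m ⟩
    (o + m) % n       ≡⟨ cong (_% n) (+-comm o m) ⟩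
    (m + o) % n       ∎

  [m+u+[n∸u]]%n≡m%n : ∀ m {u} → u ≤ n → (m + u + (n ∸ u)) % n ≡ m % n
  [m+u+[n∸u]]%n≡m%n m {u} u≤n = begin
    (m + u + (n ∸ u)) % n   ≡⟨ cong (_% n) (+-assoc m u (n ∸ u)) ⟩
    (m + (u + (n ∸ u))) % n ≡⟨ cong (λ z → (m + z) % n) (m+[n∸m]≡n u≤n) ⟩
    (m + n) % n             ≡⟨ [m+n]%n≡m%n m n ⟩
    m % n                   ∎

  -- (v - u) mod n, avoiding truncated subtraction
  offset : ℕ → ℕ → ℕ
  offset u v = (v + (n ∸ u)) % n

  offset<n : ∀ u v → offset u v < n
  offset<n u v = m%n<n _ n

  offset-+ : ∀ {u} t → u ≤ n → offset u ((u + t) % n) ≡ t % n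
  offset-+ {u} t u≤n = begin
    ((u + t) % n + (n ∸ u)) % n   ≡⟨ [m%n+o]%n≡[m+o]%n (u + t) (n ∸ u) ⟩
    (u + t + (n ∸ u)) % n         ≡⟨ cong (λ z → (z + (n ∸ u)) % n) (+-comm u t) ⟩
    (t + u + (n ∸ u)) % n         ≡⟨ [m+u+[n∸u]]%n≡m%n t u≤n ⟩
    t % n                         ∎

  +-offset : ∀ {u v} → u ≤ n → v < n → (u + offset u v) % n ≡ v
  +-offset {u} {v} u≤n v<n = begin
    (u + (v + (n ∸ u)) % n) % n   ≡⟨ [m+o%n]%n≡[m+o]%n u (v + (n ∸ u)) ⟩
    (u + (v + (n ∸ u))) % n       ≡⟨ cong (_% n) (trans (x∙yz≈y∙xz u v _) (sym (+-assoc v u _))) ⟩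
    (v + u + (n ∸ u)) % n         ≡⟨ [m+u+[n∸u]]%n≡m%n v u≤n ⟩
    v % n                         ≡⟨ m<n⇒m%n≡m v<n ⟩
    v                             ∎

  offset≤ : ∀ {u v} t → u ≤ n → (u + t) % n ≡ v → offset u v ≤ t
  offset≤ {u} t u≤n refl = ≤-trans (≤-reflexive (offset-+ t u≤n)) (m%n≤m t n)

  offset-trans : ∀ {u v w} → u < n → v < n → w < n → offset u w ≡ (offset u v + offset v w) % n
  offset-trans {u} {v} {w} u<n v<n w<n = begin
    offset u w                      ≡⟨ cong (offset u) u+[a+b]≡w ⟨
    offset u ((u + (a + b)) % n)    ≡⟨ offset-+ (a + b) (<⇒≤ u<n) ⟩
    (a + b) % n                     ∎
    where
    a b : ℕ
    a = offset u v
    b = offset v w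
    u+[a+b]≡w : (u + (a + b)) % n ≡ w
    u+[a+b]≡w = begin
      (u + (a + b)) % n       ≡⟨ cong (_% n) (+-assoc u a b) ⟨
      (u + a + b) % n         ≡⟨ [m%n+o]%n≡[m+o]%n (u + a) b ⟨
      ((u + a) % n + b) % n   ≡⟨ cong (λ z → (z + b) % n) (+-offset (<⇒≤ u<n) v<n) ⟩
      (v + b) % n             ≡⟨ +-offset (<⇒≤ v<n) w<n ⟩
      w                       ∎

  offset-self : ∀ u → u ≤ n → offset u u ≡ 0
  offset-self u u≤n = trans (cong (_% n) (m+[n∸m]≡n u≤n)) (n%n≡0 n)

  offset≡0⇒≡ : ∀ {u v} → u < n → v < n → offset u v ≡ 0 → u ≡ v
  offset≡0⇒≡ {u} {v} u<n v<n o≡0 = begin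
    u                       ≡⟨ m<n⇒m%n≡m u<n ⟨
    u % n                   ≡⟨ cong (_% n) (+-identityʳ u) ⟨
    (u + 0) % n             ≡⟨ cong (λ z → (u + z) % n) o≡0 ⟨
    (u + offset u v) % n    ≡⟨ +-offset (<⇒≤ u<n) v<n ⟩
    v                       ∎

  infix 4 _↦_
  _↦_ : ℕ → ℕ → Set
  a ↦ v = a ≡ v ⊎ a ≡ v + n

  ↦⇒%≡ : ∀ {a v} → a ↦ v → v < n → a % n ≡ v
  ↦⇒%≡ (inj₁ a≡v) v<n = trans (cong (_% n) a≡v) (m<n⇒m%n≡m v<n)
  ↦⇒%≡ {v = v} (inj₂ a≡v+n) v<n = trans (cong (_% n) a≡v+n) (trans ([m+n]%n≡m%n v n) (m<n⇒m%n≡m v<n))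

  v+[n∸u]≡[v∸u]+n : ∀ {u v} → u ≤ v → u ≤ n → v + (n ∸ u) ≡ v ∸ u + n
  v+[n∸u]≡[v∸u]+n {u} {v} u≤v u≤n = begin
    v + (n ∸ u)   ≡⟨ +-∸-assoc v u≤n ⟨
    v + n ∸ u     ≡⟨ +-∸-comm n u≤v ⟩
    v ∸ u + n     ∎

  offset-unwrap : ∀ {u v} → u < n → v < n → u + offset u v ↦ v
  offset-unwrap {u} {v} u<n v<n with u ≤? v
  ... | yes u≤v = inj₁ (begin
    u + (v + (n ∸ u)) % n   ≡⟨ cong (λ z → u + z % n) (v+[n∸u]≡[v∸u]+n u≤v (<⇒≤ u<n)) ⟩
    u + (v ∸ u + n) % n     ≡⟨ cong (u +_) ([m+n]%n≡m%n (v ∸ u) n) ⟩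
    u + (v ∸ u) % n         ≡⟨ cong (u +_) (m<n⇒m%n≡m (≤-<-trans (m∸n≤m v u) v<n)) ⟩
    u + (v ∸ u)             ≡⟨ m+[n∸m]≡n u≤v ⟩
    v                       ∎)
  ... | no u≰v = inj₂ (begin
    u + (v + (n ∸ u)) % n   ≡⟨ cong (u +_) (m<n⇒m%n≡m v+[n∸u]<n) ⟩
    u + (v + (n ∸ u))       ≡⟨ x∙yz≈y∙xz u v (n ∸ u) ⟩
    v + (u + (n ∸ u))       ≡⟨ cong (v +_) (m+[n∸m]≡n (<⇒≤ u<n)) ⟩
    v + n                   ∎)
    where
    v+[n∸u]<n : v + (n ∸ u) < n
    v+[n∸u]<n = subst (v + (n ∸ u) <_) (m+[n∸m]≡n (<⇒≤ u<n)) (+-monoˡ-< (n ∸ u) (≰⇒> u≰v))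

  ↦-no-wrap : ∀ {a v} → a < v + n → a ↦ v → a ≡ v
  ↦-no-wrap _   (inj₁ a≡v)   = a≡v
  ↦-no-wrap a<v+n (inj₂ a≡v+n) = ⊥-elim (<-irrefl a≡v+n a<v+n)

  offset-unique : ∀ {u v t} → u < n → v < n → t < n → u + t ↦ v → offset u v ≡ t
  offset-unique {u} {v} {t} u<n v<n t<n u+t↦v = begin
    offset u v                ≡⟨ cong (offset u) (↦⇒%≡ u+t↦v v<n) ⟨
    offset u ((u + t) % n)    ≡⟨ offset-+ t (<⇒≤ u<n) ⟩
    t % n                     ≡⟨ m<n⇒m%n≡m t<n ⟩
    t                         ∎

  offset+offset≡n : ∀ {u v} → u < n → v < n → u ≢ v → offset u v + offset v u ≡ n
  offset+offset≡n {u} {v} u<n v<n u≢v = begin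
    t + offset v u    ≡⟨ cong (t +_) (offset-unique v<n u<n (∸-monoʳ-< 0<t t≤n) v+[n∸t]↦u) ⟩
    t + (n ∸ t)       ≡⟨ m+[n∸m]≡n t≤n ⟩
    n                 ∎
    where
    t : ℕ
    t = offset u v
    t≤n : t ≤ n
    t≤n = <⇒≤ (offset<n u v)
    0<t : 0 < t
    0<t = n≢0⇒n>0 (u≢v ∘ offset≡0⇒≡ u<n v<n)
    v+[n∸t]↦u : v + (n ∸ t) ↦ u
    v+[n∸t]↦u with offset-unwrap u<n v<n
    ... | inj₁ u+t≡v = inj₂ (begin
      v + (n ∸ t)         ≡⟨ cong (_+ (n ∸ t)) u+t≡v ⟨
      u + t + (n ∸ t)     ≡⟨ +-assoc u t (n ∸ t) ⟩
      u + (t + (n ∸ t))   ≡⟨ cong (u +_) (m+[n∸m]≡n t≤n) ⟩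
      u + n               ∎)
    ... | inj₂ u+t≡v+n = inj₁ (begin
      v + (n ∸ t)         ≡⟨ +-∸-assoc v t≤n ⟨
      v + n ∸ t           ≡⟨ cong (_∸ t) u+t≡v+n ⟨
      u + t ∸ t           ≡⟨ m+n∸n≡m u t ⟩
      u                   ∎)

  offset-suc : ∀ {u v} → suc u < n → v < n → v ≢ u → offset u v ≡ suc (offset (suc u) v)
  offset-suc {u} {v} 1+u<n v<n v≢u = offset-unique (<-trans (n<1+n u) 1+u<n) v<n 1+t<n u+[1+t]↦v
    where
    t : ℕ
    t = offset (suc u) v
    u+[1+t]↦v : u + suc t ↦ v
    u+[1+t]↦v = subst (_↦ v) (sym (+-suc u t)) (offset-unwrap 1+u<n v<n)
    1+t≢n : suc t ≢ n
    1+t≢n 1+t≡n with subst (λ z → u + z ↦ v) 1+t≡n u+[1+t]↦v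
    ... | inj₁ u+n≡v   = <⇒≱ v<n (subst (n ≤_) u+n≡v (m≤n+m n u))
    ... | inj₂ u+n≡v+n = v≢u (sym (+-cancelʳ-≡ n u v u+n≡v+n))
    1+t<n : suc t < n
    1+t<n = ≤∧≢⇒< (offset<n (suc u) v) 1+t≢n

  offset-sucʳ : ∀ {u v} → suc u < n → v < n → v ≢ u → v ≢ suc u → offset v (suc u) ≡ suc (offset v u)
  offset-sucʳ {u} {v} 1+u<n v<n v≢u v≢1+u = +-cancelʳ-≡ t _ _ (begin
    offset v (suc u) + t    ≡⟨ offset+offset≡n v<n 1+u<n v≢1+u ⟩
    n                       ≡⟨ offset+offset≡n u<n v<n (v≢u ∘ sym) ⟨
    offset u v + a          ≡⟨ cong (_+ a) (offset-suc 1+u<n v<n v≢u) ⟩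
    suc t + a               ≡⟨ cong suc (+-comm t a) ⟩
    suc a + t               ∎)
    where
    u<n : u < n
    u<n = <-trans (n<1+n u) 1+u<n
    t a : ℕ
    t = offset (suc u) v
    a = offset v u

  +-cancelʳ-≡-mod : ∀ x y {b} → b ≤ n → (x + b) % n ≡ (y + b) % n → x % n ≡ y % n
  +-cancelʳ-≡-mod x y {b} b≤n x+b≡y+b = begin
    x % n                           ≡⟨ [m+u+[n∸u]]%n≡m%n x b≤n ⟨
    (x + b + (n ∸ b)) % n           ≡⟨ [m%n+o]%n≡[m+o]%n (x + b) (n ∸ b) ⟨
    ((x + b) % n + (n ∸ b)) % n     ≡⟨ cong (λ z → (z + (n ∸ b)) % n) x+b≡y+b ⟩
    ((y + b) % n + (n ∸ b)) % n     ≡⟨ [m%n+o]%n≡[m+o]%n (y + b) (n ∸ b) ⟩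
    (y + b + (n ∸ b)) % n           ≡⟨ [m+u+[n∸u]]%n≡m%n y b≤n ⟩
    y % n                           ∎

  circDist : ℕ → ℕ → ℕ
  circDist u v = offset u v ⊓ offset v u

  circDist≤offset : ∀ u v → circDist u v ≤ offset u v
  circDist≤offset u v = m⊓n≤m (offset u v) (offset v u)

  circDist≤offset⁻ : ∀ u v → circDist u v ≤ offset v u
  circDist≤offset⁻ u v = m⊓n≤n (offset u v) (offset v u)

  meet⇒offset≤ : ∀ {u v} a b → u < n → v < n → b ≤ n →
                 (u + a) % n ≡ (v + b) % n → b ≤ a → offset u v ≤ a ∸ b
  meet⇒offset≤ {u} {v} a b u<n v<n b≤n u+a≡v+b b≤a = offset≤ (a ∸ b) (<⇒≤ u<n) (begin
    (u + (a ∸ b)) % n   ≡⟨ +-cancelʳ-≡-mod (u + (a ∸ b)) v b≤n (trans (cong (_% n) u+[a∸b]+b≡u+a) u+a≡v+b) ⟩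
    v % n               ≡⟨ m<n⇒m%n≡m v<n ⟩
    v                   ∎)
    where
    u+[a∸b]+b≡u+a : u + (a ∸ b) + b ≡ u + a
    u+[a∸b]+b≡u+a = trans (+-assoc u (a ∸ b) b) (cong (u +_) (m∸n+n≡m b≤a))

  circDist-meet : ∀ {u v} a b → u < n → v < n → a ≤ n → b ≤ n →
              (u + a) % n ≡ (v + b) % n → circDist u v ≤ a + b
  circDist-meet {u} {v} a b u<n v<n a≤n b≤n u+a≡v+b with ≤-total b a
  ... | inj₁ b≤a = ≤-trans (circDist≤offset u v)
                     (≤-trans (meet⇒offset≤ a b u<n v<n b≤n u+a≡v+b b≤a) (≤-trans (m∸n≤m a b) (m≤m+n a b)))
  ... | inj₂ a≤b = ≤-trans (circDist≤offset⁻ u v)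
                     (≤-trans (meet⇒offset≤ b a v<n u<n a≤n (sym u+a≡v+b) a≤b) (≤-trans (m∸n≤m b a) (m≤n+m b a)))

  +-from-common-source : ∀ {u v w} a b → w < n → (w + a) % n ≡ u → (w + b) % n ≡ v → (u + b) % n ≡ (v + a) % n
  +-from-common-source {u} {v} {w} a b w<n w+a≡u w+b≡v = begin
    (u + b) % n             ≡⟨ cong (λ z → (z + b) % n) w+a≡u ⟨
    ((w + a) % n + b) % n   ≡⟨ [m%n+o]%n≡[m+o]%n (w + a) b ⟩
    (w + a + b) % n         ≡⟨ cong (_% n) (trans (+-assoc w a b) (trans (cong (w +_) (+-comm a b)) (sym (+-assoc w b a)))) ⟩
    (w + b + a) % n         ≡⟨ [m%n+o]%n≡[m+o]%n (w + b) a ⟨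
    ((w + b) % n + a) % n   ≡⟨ cong (λ z → (z + a) % n) w+b≡v ⟩
    (v + a) % n             ∎

  circDist-triangle : ∀ {u v w} → u < n → v < n → w < n → circDist u v ≤ circDist u w + circDist w v
  circDist-triangle {u} {v} {w} u<n v<n w<n = cases (⊓-sel (offset u w) (offset w u)) (⊓-sel (offset w v) (offset v w))
    where
    bound : ∀ {a b} → circDist u w ≡ a → circDist w v ≡ b → circDist u v ≤ a + b →
            circDist u v ≤ circDist u w + circDist w v
    bound refl refl h = h

    a b : ℕ
    a = offset w u
    b = offset w v

    cases : circDist u w ≡ offset u w ⊎ circDist u w ≡ offset w u →
            circDist w v ≡ offset w v ⊎ circDist w v ≡ offset v w →
            circDist u v ≤ circDist u w + circDist w v
    cases (inj₁ e₁) (inj₁ e₂) = bound e₁ e₂ (≤-trans (circDist≤offset u v)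
      (subst (_≤ offset u w + offset w v) (sym (offset-trans u<n w<n v<n)) (m%n≤m _ n)))
    cases (inj₂ e₁) (inj₂ e₂) = bound e₁ e₂ (≤-trans (circDist≤offset⁻ u v)
      (subst (_≤ offset w u + offset v w) (sym (trans (offset-trans v<n w<n u<n) (cong (_% n) (+-comm (offset v w) a))))
        (m%n≤m _ n)))
    cases (inj₁ e₁) (inj₂ e₂) = bound e₁ e₂ (circDist-meet (offset u w) (offset v w) u<n v<n
      (<⇒≤ (offset<n u w)) (<⇒≤ (offset<n v w))
      (trans (+-offset (<⇒≤ u<n) w<n) (sym (+-offset (<⇒≤ v<n) w<n))))
    cases (inj₂ e₁) (inj₁ e₂) = bound e₁ e₂ (subst (circDist u v ≤_) (+-comm b a)
      (circDist-meet b a u<n v<n (<⇒≤ (offset<n w v)) (<⇒≤ (offset<n w u))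
        (+-from-common-source a b w<n (+-offset (<⇒≤ w<n) u<n) (+-offset (<⇒≤ w<n) v<n))))

module Distance (n : ℕ) .{{_ : NonZero n}} where
  open Circulant n
  open Offsets n

  steps : List ℕ
  steps = 1 ∷ 2 ∷ 3 ∷ 4 ∷ []

  steps≤4 : All (_≤ 4) steps
  steps≤4 = s≤s z≤n ∷ s≤s (s≤s z≤n) ∷ s≤s (s≤s (s≤s z≤n)) ∷ ≤-refl ∷ []

  1≤s≤4⇒s∈steps : ∀ {s} → 1 ≤ s → s ≤ 4 → s ∈ steps
  1≤s≤4⇒s∈steps {1} _ _ = here refl
  1≤s≤4⇒s∈steps {2} _ _ = there (here refl)
  1≤s≤4⇒s∈steps {3} _ _ = there (there (here refl))
  1≤s≤4⇒s∈steps {4} _ _ = there (there (there (here refl)))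
  1≤s≤4⇒s∈steps {suc (suc (suc (suc (suc _))))} _ (s≤s (s≤s (s≤s (s≤s ()))))

  Step : Fin n → Fin n → ℕ → Bool
  Step w v s = (toℕ v ≡ᵇ (toℕ w + s) % n) ∨ (toℕ w ≡ᵇ (toℕ v + s) % n)

  step⇒circDist≤ : ∀ w v s → T (Step w v s) → circDist (toℕ w) (toℕ v) ≤ s
  step⇒circDist≤ w v s step with to (T-∨ {toℕ v ≡ᵇ (toℕ w + s) % n}) step
  ... | inj₁ e = ≤-trans (circDist≤offset (toℕ w) (toℕ v)) (offset≤ s (<⇒≤ (toℕ<n w)) (sym (≡ᵇ⇒≡ _ _ e)))
  ... | inj₂ e = ≤-trans (circDist≤offset⁻ (toℕ w) (toℕ v)) (offset≤ s (<⇒≤ (toℕ<n v)) (sym (≡ᵇ⇒≡ _ _ e)))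

  adjacent⇒circDist≤4 : ∀ w v → T (adjᵇ w v) → circDist (toℕ w) (toℕ v) ≤ 4
  adjacent⇒circDist≤4 w v adj with s≤4 , step ← lookupAny steps≤4 (any⁻ (Step w v) steps (proj₂ (to T-∧ adj)))
    = ≤-trans (step⇒circDist≤ w v _ step) s≤4

  reach⇒circDist≤4* : ∀ m u v → T (reach m u v) → circDist (toℕ u) (toℕ v) ≤ 4 * m
  reach⇒circDist≤4* zero u v u≡v rewrite ≡ᵇ⇒≡ (toℕ u) (toℕ v) u≡v =
    ≤-trans (circDist≤offset (toℕ v) (toℕ v)) (≤-reflexive (offset-self (toℕ v) (<⇒≤ (toℕ<n v))))
  reach⇒circDist≤4* (suc m) u v r with to T-∨ r
  ... | inj₁ r′ = ≤-trans (reach⇒circDist≤4* m u v r′) (*-monoʳ-≤ 4 (n≤1+n m))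
  ... | inj₂ viaAdj with w , r∧adj ← satisfied (any⁻ _ (allFin n) viaAdj) with r′ , adj ← to T-∧ r∧adj = begin
    circDist (toℕ u) (toℕ v)                          ≤⟨ circDist-triangle (toℕ<n u) (toℕ<n v) (toℕ<n w) ⟩
    circDist (toℕ u) (toℕ w) + circDist (toℕ w) (toℕ v)   ≤⟨ +-mono-≤ (reach⇒circDist≤4* m u w r′) (adjacent⇒circDist≤4 w v adj) ⟩
    4 * m + 4                                     ≡⟨ +-comm (4 * m) 4 ⟩
    4 + 4 * m                                     ≡⟨ *-suc 4 m ⟨
    4 * suc m                                     ∎
    where open ≤-Reasoning

  reach-step : ∀ m u w v s → 1 ≤ s → s ≤ 4 → T (reach m u w) → T (Step w v s) → T (reach (suc m) u v)
  reach-step m u w v s 1≤s s≤4 r step with toℕ w ≟ toℕ v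
  ... | yes w≡v = from T-∨ (inj₁ (subst (T ∘ reach m u) (toℕ-injective w≡v) r))
  ... | no  w≢v = from T-∨ (inj₂ (any⁺ _ (lose (∈-allFin w)
                    (from T-∧ (r , from T-∧ (T-not-≡ᵇ w≢v ,
                      any⁺ (Step w v) (lose (1≤s≤4⇒s∈steps 1≤s s≤4) step)))))))

  module _ (m : ℕ) (u v : Fin n) (ih : ∀ w → circDist (toℕ u) (toℕ w) ≤ 4 * m → T (reach m u w))
           (s : ℕ) (1≤s : 1 ≤ s) (s≤4 : s ≤ 4) where
    open ≡-Reasoning

    reach-clockwise : 4 * m + s ≡ offset (toℕ u) (toℕ v) → T (reach (suc m) u v)
    reach-clockwise 4m+s≡offset = reach-step m u w v s 1≤s s≤4 (ih w circDist≤4m)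
      (from T-∨ (inj₁ (≡⇒≡ᵇ _ _ (sym w+s≡v))))
      where
      w : Fin n
      w = (toℕ u + 4 * m) mod n
      circDist≤4m : circDist (toℕ u) (toℕ w) ≤ 4 * m
      circDist≤4m = ≤-trans (circDist≤offset (toℕ u) (toℕ w)) (offset≤ (4 * m) (<⇒≤ (toℕ<n u)) (sym (toℕ-mod _ n)))
      w+s≡v : (toℕ w + s) % n ≡ toℕ v
      w+s≡v = begin
        (toℕ w + s) % n                 ≡⟨ cong (λ z → (z + s) % n) (toℕ-mod _ n) ⟩
        ((toℕ u + 4 * m) % n + s) % n   ≡⟨ [m%n+o]%n≡[m+o]%n (toℕ u + 4 * m) s ⟩
        (toℕ u + 4 * m + s) % n         ≡⟨ cong (_% n) (trans (+-assoc (toℕ u) (4 * m) s) (cong (toℕ u +_) 4m+s≡offset)) ⟩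
        (toℕ u + offset (toℕ u) (toℕ v)) % n   ≡⟨ +-offset (<⇒≤ (toℕ<n u)) (toℕ<n v) ⟩
        toℕ v                           ∎

    reach-anticlockwise : 4 * m + s ≡ offset (toℕ v) (toℕ u) → T (reach (suc m) u v)
    reach-anticlockwise 4m+s≡offset = reach-step m u w v s 1≤s s≤4 (ih w circDist≤4m)
      (from T-∨ (inj₂ (≡⇒≡ᵇ _ _ (toℕ-mod _ n))))
      where
      w : Fin n
      w = (toℕ v + s) mod n
      w+4m≡u : (toℕ w + 4 * m) % n ≡ toℕ u
      w+4m≡u = begin
        (toℕ w + 4 * m) % n             ≡⟨ cong (λ z → (z + 4 * m) % n) (toℕ-mod _ n) ⟩
        ((toℕ v + s) % n + 4 * m) % n   ≡⟨ [m%n+o]%n≡[m+o]%n (toℕ v + s) (4 * m) ⟩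
        (toℕ v + s + 4 * m) % n         ≡⟨ cong (_% n) (trans (+-assoc (toℕ v) s (4 * m))
                                             (cong (toℕ v +_) (trans (+-comm s (4 * m)) 4m+s≡offset))) ⟩
        (toℕ v + offset (toℕ v) (toℕ u)) % n   ≡⟨ +-offset (<⇒≤ (toℕ<n v)) (toℕ<n u) ⟩
        toℕ u                           ∎
      circDist≤4m : circDist (toℕ u) (toℕ w) ≤ 4 * m
      circDist≤4m = ≤-trans (circDist≤offset⁻ (toℕ u) (toℕ w)) (offset≤ (4 * m) (<⇒≤ (toℕ<n w)) w+4m≡u)

  circDist≤4*⇒reach : ∀ m u v → circDist (toℕ u) (toℕ v) ≤ 4 * m → T (reach m u v)
  circDist≤4*⇒reach zero u v circDist≤0 with ⊓-sel (offset (toℕ u) (toℕ v)) (offset (toℕ v) (toℕ u))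
  ... | inj₁ e = ≡⇒≡ᵇ _ _ (offset≡0⇒≡ (toℕ<n u) (toℕ<n v) (n≤0⇒n≡0 (subst (_≤ 0) e circDist≤0)))
  ... | inj₂ e = ≡⇒≡ᵇ _ _ (sym (offset≡0⇒≡ (toℕ<n v) (toℕ<n u) (n≤0⇒n≡0 (subst (_≤ 0) e circDist≤0))))
  circDist≤4*⇒reach (suc m) u v circDist≤4+4m with circDist (toℕ u) (toℕ v) ≤? 4 * m
  ... | yes circDist≤4m = from T-∨ (inj₁ (circDist≤4*⇒reach m u v circDist≤4m))
  ... | no  circDist≰4m
    with s , 1≤s , s≤4 , 4m+s≡circDistDist ← 4*m<c≤4*[1+m]⇒4*m+s≡c m (≰⇒> circDist≰4m) circDist≤4+4m
       | ⊓-sel (offset (toℕ u) (toℕ v)) (offset (toℕ v) (toℕ u))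
  ... | inj₁ e = reach-clockwise m u v (circDist≤4*⇒reach m u) s 1≤s s≤4 (trans 4m+s≡circDistDist e)
  ... | inj₂ e = reach-anticlockwise m u v (circDist≤4*⇒reach m u) s 1≤s s≤4 (trans 4m+s≡circDistDist e)

  firstFrom≡ : ∀ fuel cur (f : ℕ → Bool) q → (∀ j → T (f j) → q ≤ j) → (∀ j → q ≤ j → T (f j)) →
               cur ≤ q → q < cur + fuel → firstFrom fuel cur f ≡ q
  firstFrom≡ zero cur f q _ _ cur≤q q<cur+0 = ⊥-elim (<⇒≱ q<cur+0 (subst (_≤ q) (sym (+-identityʳ cur)) cur≤q))
  firstFrom≡ (suc fuel) cur f q f⇒q≤ q≤⇒f cur≤q q<cur+1+fuel with f cur in f-cur
  ... | true  = ≤-antisym cur≤q (f⇒q≤ cur (subst T (sym f-cur) _))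
  ... | false = firstFrom≡ fuel (suc cur) f q f⇒q≤ q≤⇒f (≤∧≢⇒< cur≤q cur≢q) (subst (q <_) (+-suc cur fuel) q<cur+1+fuel)
    where
    cur≢q : cur ≢ q
    cur≢q refl = subst T f-cur (q≤⇒f cur ≤-refl)

  dist≡⌈circDist/4⌉ : ∀ u v → dist u v ≡ ⌈ circDist (toℕ u) (toℕ v) /4⌉
  dist≡⌈circDist/4⌉ u v = firstFrom≡ n 0 (λ m → reach m u v) ⌈ c /4⌉
    (λ m r → m≤4*n⇒⌈m/4⌉≤n c m (reach⇒circDist≤4* m u v r))
    (λ m ⌈c/4⌉≤m → circDist≤4*⇒reach m u v (⌈m/4⌉≤n⇒m≤4*n c m ⌈c/4⌉≤m))
    z≤n
    (≤-<-trans (⌈m/4⌉≤m c) (≤-<-trans (circDist≤offset (toℕ u) (toℕ v)) (offset<n (toℕ u) (toℕ v))))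
    where
    c : ℕ
    c = circDist (toℕ u) (toℕ v)

  ¬SameRep⇒∃-dist≢ : ∀ X a b → ¬ SameRep X a b → ∃[ x ] x Subset.∈ X × dist a x ≢ dist b x
  ¬SameRep⇒∃-dist≢ X a b ¬same =
    let x , ¬P = ¬∀⟶∃¬ n P P? ¬same in x , x∈X ¬P , (λ e → ¬P (λ _ → e))
    where
    P : Fin n → Set
    P x = x Subset.∈ X → dist a x ≡ dist b x
    P? : ∀ x → Dec (P x)
    P? x with x ∈? X | dist a x ≟ dist b x
    ... | no  x∉X | _       = yes (⊥-elim ∘ x∉X)
    ... | yes _   | yes eq  = yes (λ _ → eq)
    ... | yes x∈X | no  ≢   = no (λ p → ≢ (p x∈X))
    x∈X : ∀ {x} → ¬ P x → x Subset.∈ X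
    x∈X {x} ¬P with x ∈? X
    ... | yes x∈X = x∈X
    ... | no  x∉X = ⊥-elim (¬P (⊥-elim ∘ x∉X))

3≤∣p∣ : ∀ {n} {x y z : Fin n} {p : Subset n} → x ≢ y → x ≢ z → y ≢ z →
        x Subset.∈ p → y Subset.∈ p → z Subset.∈ p → 3 ≤ ∣ p ∣
3≤∣p∣ {x = x} {y} {z} {p} x≢y x≢z y≢z x∈p y∈p z∈p =
  ≤-trans (s≤s (≤-trans (s≤s (≤-trans (s≤s z≤n) ∣p-x-y-z∣<∣p-x-y∣)) ∣p-x-y∣<∣p-x∣)) ∣p-x∣<∣p∣
  where
  ∣p-x∣<∣p∣ : ∣ p - x ∣ < ∣ p ∣
  ∣p-x∣<∣p∣ = x∈p⇒∣p-x∣<∣p∣ x∈p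
  ∣p-x-y∣<∣p-x∣ : ∣ p - x - y ∣ < ∣ p - x ∣
  ∣p-x-y∣<∣p-x∣ = x∈p⇒∣p-x∣<∣p∣ (x∈p∧x≢y⇒x∈p-y y∈p (x≢y ∘ sym))
  ∣p-x-y-z∣<∣p-x-y∣ : ∣ p - x - y - z ∣ < ∣ p - x - y ∣
  ∣p-x-y-z∣<∣p-x-y∣ = x∈p⇒∣p-x∣<∣p∣ (x∈p∧x≢y⇒x∈p-y (x∈p∧x≢y⇒x∈p-y z∈p (x≢z ∘ sym)) (y≢z ∘ sym))

k+d<ᵇk : ∀ k d → (k + d <ᵇ k) ≡ false
k+d<ᵇk zero    d = refl
k+d<ᵇk (suc k) d = k+d<ᵇk k d

k+d≡ᵇk : ∀ k d → (k + d ≡ᵇ k) ≡ (d ≡ᵇ 0)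
k+d≡ᵇk zero    d = refl
k+d≡ᵇk (suc k) d = k+d≡ᵇk k d

k+d≡ᵇ1+k : ∀ k d → (k + d ≡ᵇ suc k) ≡ (d ≡ᵇ 1)
k+d≡ᵇ1+k zero    d = refl
k+d≡ᵇ1+k (suc k) d = k+d≡ᵇ1+k k d

clusterA-↑ʳ : ∀ k m (i : Fin 3) → clusterA k m (k ↑ʳ i) ≡
  (if toℕ i ≡ᵇ 0 then vtx k (3 + 4 * k) ∷ vtx k (4 + 4 * k) ∷ vtx k (5 + 4 * k) ∷ []
   else if toℕ i ≡ᵇ 1 then vtx k (3 + 4 * (k + m)) ∷ vtx k (4 + 4 * (k + m)) ∷ []
   else vtx k (5 + 4 * (k + m)) ∷ vtx k (6 + 4 * (k + m)) ∷ [])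
clusterA-↑ʳ k m i rewrite toℕ-↑ʳ k i | k+d<ᵇk k (toℕ i) | k+d≡ᵇk k (toℕ i) | k+d≡ᵇ1+k k (toℕ i) = refl

pair∈A₀ : ∀ k m → vtx (suc k) 3 ∈ clusterA (suc k) m zero × vtx (suc k) 4 ∈ clusterA (suc k) m zero
pair∈A₀ k m = here refl , there (here refl)

pair∈Aₖ : ∀ k m → vtx k (4 + 4 * k) ∈ clusterA k m (k ↑ʳ zero) × vtx k (5 + 4 * k) ∈ clusterA k m (k ↑ʳ zero)
pair∈Aₖ k m rewrite clusterA-↑ʳ k m zero = there (here refl) , there (there (here refl))

pair∈B₁ : ∀ k m → vtx k (3 + 4 * (k + m)) ∈ clusterA k m (k ↑ʳ suc zero) ×
                  vtx k (4 + 4 * (k + m)) ∈ clusterA k m (k ↑ʳ suc zero)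
pair∈B₁ k m rewrite clusterA-↑ʳ k m (suc zero) = here refl , there (here refl)

pair∈B₂ : ∀ k m → vtx k (5 + 4 * (k + m)) ∈ clusterA k m (k ↑ʳ suc (suc zero)) ×
                  vtx k (6 + 4 * (k + m)) ∈ clusterA k m (k ↑ʳ suc (suc zero))
pair∈B₂ k m rewrite clusterA-↑ʳ k m (suc (suc zero)) = here refl , there (here refl)

module Splitting (k : ℕ) where
  open Circulant (N k) using (dist; Resolves)
  open Offsets (N k)
  open Distance (N k) using (dist≡⌈circDist/4⌉; ¬SameRep⇒∃-dist≢)

  k≤2*k : k ≤ 2 * k
  k≤2*k = m≤m+n k (k + 0)

  c+4*j<n : ∀ {c j} → c ≤ 6 → j ≤ 2 * k → c + 4 * j < N k
  c+4*j<n {c} {j} c≤6 j≤2k = s≤s (begin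
    c + 4 * j         ≤⟨ +-mono-≤ c≤6 (*-monoʳ-≤ 4 j≤2k) ⟩
    6 + 4 * (2 * k)   ≡⟨ cong (6 +_) (sym (*-assoc 4 2 k)) ⟩
    6 + 8 * k         ∎)
    where open ≤-Reasoning

  -- necessary for x to distinguish u from u + 1 in ℤ_n, n = 8k + 7
  data Splits (u x : ℕ) : Set where
    ahead  : ∀ {j} → j ≤ k → u + suc (4 * j) ↦ x → Splits u x
    behind : ∀ {j} → j ≤ k → x + 4 * j ↦ u → Splits u x

  ⌈circDist/4⌉-differs⇒Splits : ∀ {u x} → suc u < N k → x < N k →
                             ⌈ circDist u x /4⌉ ≢ ⌈ circDist (suc u) x /4⌉ → Splits u x
  ⌈circDist/4⌉-differs⇒Splits {u} {x} 1+u<n x<n ⌈⌉≢⌈⌉ with x ≟ u | x ≟ suc u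
  ... | yes refl | _ = behind z≤n (inj₁ (+-identityʳ x))
  ... | no _ | yes refl = ahead z≤n (inj₁ (+-comm u 1))
  ... | no x≢u | no x≢1+u = from-jump (⌈1+t⊓a/4⌉≢⌈t⊓1+a/4⌉⇒4∣t⊎4∣a k t+a≡6+8k (⌈⌉≢⌈⌉ ∘ arcs))
    where
    open ≡-Reasoning
    u<n : u < N k
    u<n = <-trans (n<1+n u) 1+u<n
    t a : ℕ
    t = offset (suc u) x
    a = offset x u
    offset[u,x]≡1+t : offset u x ≡ suc t
    offset[u,x]≡1+t = offset-suc 1+u<n x<n x≢u
    1+t+a≡n : suc t + a ≡ N k
    1+t+a≡n = trans (cong (_+ a) (sym offset[u,x]≡1+t)) (offset+offset≡n u<n x<n (x≢u ∘ sym))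
    t+a≡6+8k : t + a ≡ 6 + 8 * k
    t+a≡6+8k = suc-injective 1+t+a≡n
    arcs : ⌈ suc t ⊓ a /4⌉ ≡ ⌈ t ⊓ suc a /4⌉ → ⌈ circDist u x /4⌉ ≡ ⌈ circDist (suc u) x /4⌉
    arcs e = begin
      ⌈ circDist u x /4⌉        ≡⟨ cong (λ z → ⌈ z ⊓ a /4⌉) offset[u,x]≡1+t ⟩
      ⌈ suc t ⊓ a /4⌉           ≡⟨ e ⟩
      ⌈ t ⊓ suc a /4⌉           ≡⟨ cong (λ z → ⌈ t ⊓ z /4⌉) (offset-sucʳ 1+u<n x<n x≢u x≢1+u) ⟨
      ⌈ circDist (suc u) x /4⌉  ∎
    from-jump : (∃[ j ] j ≤ k × t ≡ 4 * j) ⊎ (∃[ j ] j ≤ k × a ≡ 4 * j) → Splits u x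
    from-jump (inj₁ (j , j≤k , t≡4j)) =
      ahead j≤k (subst (λ z → u + z ↦ x) (trans offset[u,x]≡1+t (cong suc t≡4j)) (offset-unwrap u<n x<n))
    from-jump (inj₂ (j , j≤k , a≡4j)) =
      behind j≤k (subst (λ z → x + z ↦ u) a≡4j (offset-unwrap x<n u<n))

  ahead-bound : ∀ u {j} x → u + suc (4 * k) < N k → j ≤ k → u + suc (4 * j) < x + N k
  ahead-bound u x u+1+4k<n j≤k =
    <-≤-trans (≤-<-trans (+-monoʳ-≤ u (s≤s (*-monoʳ-≤ 4 j≤k))) u+1+4k<n) (m≤n+m (N k) x)

  behind-bound : ∀ {u x j} → x < N k → j ≤ k → 4 * k ≤ u → x + 4 * j < u + N k
  behind-bound {u} {x} {j} x<n j≤k 4k≤u =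
    subst (x + 4 * j <_) (+-comm (N k) u) (+-mono-<-≤ x<n (≤-trans (*-monoʳ-≤ 4 j≤k) 4k≤u))

  4*[i+j]+r≡4*i+r+4*j : ∀ i r j → 4 * (i + j) + r ≡ 4 * i + r + 4 * j
  4*[i+j]+r≡4*i+r+4*j = solve-∀

  -- The splitters x = 4 i + r of the chosen pairs of A₀, Aₖ, B₁ and B₂, as predicates on (r, i),
  -- recorded only as finely as needed to tell them apart.
  SplitterA₀ : ℕ → ℕ → Set
  SplitterA₀ 0 i = i ≤ suc k
  SplitterA₀ 2 i = ⊤
  SplitterA₀ 3 i = i ≡ 0
  SplitterA₀ _ i = ⊥

  splitterA₀ : ∀ {i r} → r < 4 → Splits 3 (4 * i + r) → SplitterA₀ r i
  splitterA₀ {i} {r} r<4 (ahead {j} j≤k 3+[1+4j]↦x) =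
    let 0≡r , 1+j≡i = 4*q+r≡4*q′+r′⇒r≡r′×q≡q′ (suc j) i z<s r<4 (trans (4*[1+j]≡3+[1+4*j] j)
                         (↦-no-wrap (ahead-bound 3 (4 * i + r) (c+4*j<n (m≤m+n 4 2) k≤2*k) j≤k) 3+[1+4j]↦x))
    in  subst₂ SplitterA₀ 0≡r 1+j≡i (s≤s j≤k)
    where
    4*[1+j]≡3+[1+4*j] : ∀ j → 4 * suc j + 0 ≡ 3 + suc (4 * j)
    4*[1+j]≡3+[1+4*j] = solve-∀
  splitterA₀ {i} {r} r<4 (behind {j} j≤k (inj₁ x+4j≡3)) =
    let r≡3 , i+j≡0 = 4*q+r≡4*q′+r′⇒r≡r′×q≡q′ (i + j) 0 r<4 (s<s (s<s (s<s z<s)))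
                        (trans (4*[i+j]+r≡4*i+r+4*j i r j) x+4j≡3)
    in  subst (λ r → SplitterA₀ r i) (sym r≡3) (m+n≡0⇒m≡0 i i+j≡0)
  splitterA₀ {i} {r} r<4 (behind {j} j≤k (inj₂ x+4j≡3+n)) =
    let r≡2 , _ = 4*q+r≡4*q′+r′⇒r≡r′×q≡q′ (i + j) (2 + 2 * k) r<4 (s<s (s<s z<s))
                    (trans (4*[i+j]+r≡4*i+r+4*j i r j) (trans x+4j≡3+n (3+n≡4*[2+2*k]+2 k)))
    in  subst (λ r → SplitterA₀ r i) (sym r≡2) tt
    where
    3+n≡4*[2+2*k]+2 : ∀ k → 3 + (7 + 8 * k) ≡ 4 * (2 + 2 * k) + 2
    3+n≡4*[2+2*k]+2 = solve-∀

  SplitterAₖ : ℕ → ℕ → Set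
  SplitterAₖ 0 i = i ≤ suc k
  SplitterAₖ 1 i = suc k ≤ i
  SplitterAₖ _ i = ⊥

  splitterAₖ : ∀ {i r} → r < 4 → 4 * i + r < N k → Splits (4 + 4 * k) (4 * i + r) → SplitterAₖ r i
  splitterAₖ {i} {r} r<4 _ (ahead {j} j≤k u+[1+4j]↦x) =
    let 1≡r , 1+k+j≡i = 4*q+r≡4*q′+r′⇒r≡r′×q≡q′ (suc k + j) i (s<s z<s) r<4 (trans (4*[1+k+j]+1≡4+4*k+[1+4*j] k j)
                           (↦-no-wrap (ahead-bound (4 + 4 * k) (4 * i + r) (bound k) j≤k) u+[1+4j]↦x))
    in  subst₂ SplitterAₖ 1≡r 1+k+j≡i (m≤m+n (suc k) j)
    where
    4*[1+k+j]+1≡4+4*k+[1+4*j] : ∀ k j → 4 * (suc k + j) + 1 ≡ 4 + 4 * k + suc (4 * j)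
    4*[1+k+j]+1≡4+4*k+[1+4*j] = solve-∀
    bound : ∀ k → 4 + 4 * k + suc (4 * k) < N k
    bound k = subst (_< N k) (5+8*k≡4+4*k+[1+4*k] k) (n≤1+n (6 + 8 * k))
      where
      5+8*k≡4+4*k+[1+4*k] : ∀ k → 5 + 8 * k ≡ 4 + 4 * k + suc (4 * k)
      5+8*k≡4+4*k+[1+4*k] = solve-∀
  splitterAₖ {i} {r} r<4 x<n (behind {j} j≤k x+4j↦u) =
    let r≡0 , i+j≡1+k = 4*q+r≡4*q′+r′⇒r≡r′×q≡q′ (i + j) (suc k) r<4 z<s (trans (4*[i+j]+r≡4*i+r+4*j i r j)
                           (trans (↦-no-wrap (behind-bound x<n j≤k (m≤n+m (4 * k) 4)) x+4j↦u) (4+4*k≡4*[1+k] k)))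
    in  subst (λ r → SplitterAₖ r i) (sym r≡0) (subst (i ≤_) i+j≡1+k (m≤m+n i j))
    where
    4+4*k≡4*[1+k] : ∀ k → 4 + 4 * k ≡ 4 * suc k + 0
    4+4*k≡4*[1+k] = solve-∀

  i+j≡k+m⇒m≤i : ∀ {i j m} → j ≤ k → i + j ≡ k + m → m ≤ i
  i+j≡k+m⇒m≤i {i} {j} {m} j≤k i+j≡k+m =
    +-cancelˡ-≤ k m i (≤-trans (≤-reflexive (sym i+j≡k+m)) (≤-trans (+-monoʳ-≤ i j≤k) (≤-reflexive (+-comm i k))))

  k+m+j≡i+2*k+1⇒i<m : ∀ {i j m} → j ≤ k → k + m + j ≡ i + 2 * k + 1 → suc i ≤ m
  k+m+j≡i+2*k+1⇒i<m {i} {j} {m} j≤k k+m+j≡i+2k+1 = +-cancelʳ-≤ (k + k) (suc i) m (begin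
    suc i + (k + k)     ≡⟨ [1+i]+2*k≡i+2*k+1 i k ⟩
    i + 2 * k + 1       ≡⟨ k+m+j≡i+2k+1 ⟨
    k + m + j           ≤⟨ +-monoʳ-≤ (k + m) j≤k ⟩
    k + m + k           ≡⟨ k+m+k≡m+2*k k m ⟩
    m + (k + k)         ∎)
    where
    open ≤-Reasoning
    [1+i]+2*k≡i+2*k+1 : ∀ i k → suc i + (k + k) ≡ i + 2 * k + 1
    [1+i]+2*k≡i+2*k+1 = solve-∀
    k+m+k≡m+2*k : ∀ k m → k + m + k ≡ m + (k + k)
    k+m+k≡m+2*k = solve-∀


  module _ (m : ℕ) where

    SplitterB₁ : ℕ → ℕ → Set
    SplitterB₁ 0 i = suc (k + m) ≤ i
    SplitterB₁ 1 i = suc i ≤ m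
    SplitterB₁ 3 i = m ≤ i
    SplitterB₁ _ i = ⊥

    splitterB₁ : ∀ {i r} → r < 4 → 4 * i + r < N k → Splits (3 + 4 * (k + m)) (4 * i + r) → SplitterB₁ r i
    splitterB₁ {i} {r} r<4 _ (ahead {j} j≤k (inj₁ u+[1+4j]≡x)) =
      let 0≡r , 1+k+m+j≡i = 4*q+r≡4*q′+r′⇒r≡r′×q≡q′ (suc (k + m + j)) i z<s r<4
                              (trans (4*[1+k+m+j]≡3+4*[k+m]+[1+4*j] k m j) u+[1+4j]≡x)
      in  subst₂ SplitterB₁ 0≡r 1+k+m+j≡i (s≤s (m≤m+n (k + m) j))
    splitterB₁ {i} {r} r<4 _ (ahead {j} j≤k (inj₂ u+[1+4j]≡x+n)) =
      let r≡1 , 1+k+m+j≡1+q = 4*q+[r+3]≡4*q′+r′⇒r≡1+r′×q′≡1+q (i + 2 * k + 1) (suc (k + m + j)) r<4 z<s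
                                 (trans (4*[i+2*k+1]+[r+3]≡4*i+r+n k i r)
                                   (trans (sym u+[1+4j]≡x+n) (sym (4*[1+k+m+j]≡3+4*[k+m]+[1+4*j] k m j))))
      in  subst (λ r → SplitterB₁ r i) (sym r≡1) (k+m+j≡i+2*k+1⇒i<m j≤k (suc-injective 1+k+m+j≡1+q))
    splitterB₁ {i} {r} r<4 x<n (behind {j} j≤k x+4j↦u) =
      let r≡3 , i+j≡k+m = 4*q+r≡4*q′+r′⇒r≡r′×q≡q′ (i + j) (k + m) r<4 (s<s (s<s (s<s z<s)))
                            (trans (4*[i+j]+r≡4*i+r+4*j i r j)
                              (trans (↦-no-wrap (behind-bound x<n j≤k 4k≤u) x+4j↦u) (+-comm 3 (4 * (k + m)))))
      in  subst (λ r → SplitterB₁ r i) (sym r≡3) (i+j≡k+m⇒m≤i j≤k i+j≡k+m)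
      where
      4k≤u : 4 * k ≤ 3 + 4 * (k + m)
      4k≤u = m≤n⇒m≤o+n 3 (*-monoʳ-≤ 4 (m≤m+n k m))

    SplitterB₂ : ℕ → ℕ → Set
    SplitterB₂ 1 i = suc m ≤ i
    SplitterB₂ 2 i = ⊤
    SplitterB₂ 3 i = suc i ≤ m
    SplitterB₂ _ i = ⊥

    splitterB₂ : ∀ {i r} → r < 4 → 4 * i + r < N k → Splits (5 + 4 * (k + m)) (4 * i + r) → SplitterB₂ r i
    splitterB₂ {i} {r} r<4 _ (ahead {j} j≤k (inj₁ u+[1+4j]≡x)) =
      let 2≡r , _ = 4*q+r≡4*q′+r′⇒r≡r′×q≡q′ (suc (k + m + j)) i (s<s (s<s z<s)) r<4
                      (trans (4*[1+k+m+j]+2≡5+4*[k+m]+[1+4*j] k m j) u+[1+4j]≡x)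
      in  subst (λ r → SplitterB₂ r i) 2≡r tt
    splitterB₂ {i} {r} r<4 _ (ahead {j} j≤k (inj₂ u+[1+4j]≡x+n)) =
      let r≡3 , 1+k+m+j≡1+q = 4*q+[r+3]≡4*q′+r′⇒r≡1+r′×q′≡1+q (i + 2 * k + 1) (suc (k + m + j)) r<4 (s<s (s<s z<s))
                                 (trans (4*[i+2*k+1]+[r+3]≡4*i+r+n k i r)
                                   (trans (sym u+[1+4j]≡x+n) (sym (4*[1+k+m+j]+2≡5+4*[k+m]+[1+4*j] k m j))))
      in  subst (λ r → SplitterB₂ r i) (sym r≡3) (k+m+j≡i+2*k+1⇒i<m j≤k (suc-injective 1+k+m+j≡1+q))
    splitterB₂ {i} {r} r<4 x<n (behind {j} j≤k x+4j↦u) =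
      let r≡1 , i+j≡1+k+m = 4*q+r≡4*q′+r′⇒r≡r′×q≡q′ (i + j) (suc (k + m)) r<4 (s<s z<s)
                              (trans (4*[i+j]+r≡4*i+r+4*j i r j)
                                (trans (↦-no-wrap (behind-bound x<n j≤k 4k≤u) x+4j↦u) (5+4*[k+m]≡4*[1+k+m]+1 k m)))
      in  subst (λ r → SplitterB₂ r i) (sym r≡1) (i+j≡k+m⇒m≤i j≤k (trans i+j≡1+k+m (sym (+-suc k m))))
      where
      4k≤u : 4 * k ≤ 5 + 4 * (k + m)
      4k≤u = m≤n⇒m≤o+n 5 (*-monoʳ-≤ 4 (m≤m+n k m))
      5+4*[k+m]≡4*[1+k+m]+1 : ∀ k m → 5 + 4 * (k + m) ≡ 4 * suc (k + m) + 1
      5+4*[k+m]≡4*[1+k+m]+1 = solve-∀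

  module _ {m : ℕ} (1≤m : 1 ≤ m) where

    1+k+m≰1+k : suc (k + m) ≰ suc k
    1+k+m≰1+k 1+k+m≤1+k = <-irrefl refl (≤-trans (subst (_≤ k + m) (+-comm k 1) (+-monoʳ-≤ k 1≤m)) (s≤s⁻¹ 1+k+m≤1+k))

    SplitterB₁⇒¬SplitterA₀ : ∀ r {i} → SplitterB₁ m r i → ¬ SplitterA₀ r i
    SplitterB₁⇒¬SplitterA₀ 0 1+k+m≤i i≤1+k = 1+k+m≰1+k (≤-trans 1+k+m≤i i≤1+k)
    SplitterB₁⇒¬SplitterA₀ 1 _ ()
    SplitterB₁⇒¬SplitterA₀ 2 ()
    SplitterB₁⇒¬SplitterA₀ 3 m≤i refl = <⇒≱ 1≤m m≤i
    SplitterB₁⇒¬SplitterA₀ (suc (suc (suc (suc _)))) ()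

    SplitterB₁⇒¬SplitterAₖ : m ≤ k → ∀ r {i} → SplitterB₁ m r i → ¬ SplitterAₖ r i
    SplitterB₁⇒¬SplitterAₖ _   0 1+k+m≤i i≤1+k = 1+k+m≰1+k (≤-trans 1+k+m≤i i≤1+k)
    SplitterB₁⇒¬SplitterAₖ m≤k 1 1+i≤m 1+k≤i = <-irrefl refl (≤-trans 1+i≤m (≤-trans m≤k (≤-trans (n≤1+n k) 1+k≤i)))
    SplitterB₁⇒¬SplitterAₖ _   2 ()
    SplitterB₁⇒¬SplitterAₖ _   3 _ ()
    SplitterB₁⇒¬SplitterAₖ _   (suc (suc (suc (suc _)))) ()

  SplitterB₁⇒¬SplitterB₂ : ∀ {m} r {i} → SplitterB₁ m r i → ¬ SplitterB₂ m r i
  SplitterB₁⇒¬SplitterB₂ 0 _ ()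
  SplitterB₁⇒¬SplitterB₂ 1 1+i≤m 1+m≤i = <-irrefl refl (≤-trans 1+i≤m (≤-trans (n≤1+n _) 1+m≤i))
  SplitterB₁⇒¬SplitterB₂ 2 ()
  SplitterB₁⇒¬SplitterB₂ 3 m≤i 1+i≤m = <-irrefl refl (≤-trans 1+i≤m m≤i)
  SplitterB₁⇒¬SplitterB₂ (suc (suc (suc (suc _)))) ()

  ¬SplitterA₀∧SplitterAₖ∧SplitterB₂ : ∀ {m} r {i} → SplitterA₀ r i → SplitterAₖ r i → ¬ SplitterB₂ m r i
  ¬SplitterA₀∧SplitterAₖ∧SplitterB₂ 0 _ _ ()
  ¬SplitterA₀∧SplitterAₖ∧SplitterB₂ 1 ()
  ¬SplitterA₀∧SplitterAₖ∧SplitterB₂ 2 _ ()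
  ¬SplitterA₀∧SplitterAₖ∧SplitterB₂ 3 _ ()
  ¬SplitterA₀∧SplitterAₖ∧SplitterB₂ (suc (suc (suc (suc _)))) ()

  toℕ-vtx : ∀ {a} → a < N k → toℕ (vtx k a) ≡ a
  toℕ-vtx {a} a<n = trans (toℕ-mod a (N k)) (m<n⇒m%n≡m a<n)

  dist-differs⇒Splits : ∀ {a} x → suc a < N k → dist (vtx k a) x ≢ dist (vtx k (suc a)) x →
                        Splits a (toℕ x)
  dist-differs⇒Splits {a} x 1+a<n d≢d = ⌈circDist/4⌉-differs⇒Splits 1+a<n (toℕ<n x) (d≢d ∘ dist≡dist)
    where
    open ≡-Reasoning
    a<n : a < N k
    a<n = <-trans (n<1+n a) 1+a<n
    dist≡dist : ⌈ circDist a (toℕ x) /4⌉ ≡ ⌈ circDist (suc a) (toℕ x) /4⌉ →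
                dist (vtx k a) x ≡ dist (vtx k (suc a)) x
    dist≡dist e = begin
      dist (vtx k a) x                               ≡⟨ dist≡⌈circDist/4⌉ (vtx k a) x ⟩
      ⌈ circDist (toℕ (vtx k a)) (toℕ x) /4⌉         ≡⟨ cong (λ z → ⌈ circDist z (toℕ x) /4⌉) (toℕ-vtx a<n) ⟩
      ⌈ circDist a (toℕ x) /4⌉                       ≡⟨ e ⟩
      ⌈ circDist (suc a) (toℕ x) /4⌉                 ≡⟨ cong (λ z → ⌈ circDist z (toℕ x) /4⌉) (toℕ-vtx 1+a<n) ⟨
      ⌈ circDist (toℕ (vtx k (suc a))) (toℕ x) /4⌉   ≡⟨ dist≡⌈circDist/4⌉ (vtx k (suc a)) x ⟨
      dist (vtx k (suc a)) x                         ∎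

  At : (ℕ → ℕ → Set) → Fin (N k) → Set
  At P x = P (toℕ x % 4) (toℕ x / 4)

  at-quotRem : ∀ {u} (P : ℕ → ℕ → Set) → (∀ {i r} → r < 4 → 4 * i + r < N k → Splits u (4 * i + r) → P r i) →
               ∀ x → Splits u (toℕ x) → At P x
  at-quotRem P classify x splits =
    classify (m%n<n (toℕ x) 4) (subst (_< N k) x≡4q+r (toℕ<n x)) (subst (Splits _) x≡4q+r splits)
    where
    x≡4q+r : toℕ x ≡ 4 * (toℕ x / 4) + toℕ x % 4
    x≡4q+r = trans (m≡m%n+[m/n]*n (toℕ x) 4) (trans (+-comm (toℕ x % 4) _) (cong (_+ toℕ x % 4) (*-comm (toℕ x / 4) 4)))

  module _ {m : ℕ} (X : Subset (N k)) (resolves : Resolves X (k + 3) (clusterA k m)) where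

    splitter∈X : ∀ {a} (P : ℕ → ℕ → Set) → (∀ {i r} → r < 4 → 4 * i + r < N k → Splits a (4 * i + r) → P r i) →
                 ∀ t → suc a < N k → vtx k a ∈ clusterA k m t × vtx k (suc a) ∈ clusterA k m t →
                 ∃[ x ] x Subset.∈ X × At P x
    splitter∈X {a} P classify t 1+a<n (a∈A , 1+a∈A) =
      let x , x∈X , d≢d = ¬SameRep⇒∃-dist≢ X (vtx k a) (vtx k (suc a)) (resolves t _ _ a∈A 1+a∈A vtx[a]≢vtx[1+a])
      in  x , x∈X , at-quotRem P classify x (dist-differs⇒Splits x 1+a<n d≢d)
      where
      vtx[a]≢vtx[1+a] : vtx k a ≢ vtx k (suc a)
      vtx[a]≢vtx[1+a] e = 1+n≢n (sym (trans (sym (toℕ-vtx (<-trans (n<1+n a) 1+a<n))) (trans (cong toℕ e) (toℕ-vtx 1+a<n))))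

  splitters⇒3≤∣X∣ : ∀ {m} → 1 ≤ m → m ≤ k → (X : Subset (N k)) →
          ∃[ x ] x Subset.∈ X × At SplitterA₀ x → ∃[ x ] x Subset.∈ X × At SplitterAₖ x →
          ∃[ x ] x Subset.∈ X × At (SplitterB₁ m) x → ∃[ x ] x Subset.∈ X × At (SplitterB₂ m) x → 3 ≤ ∣ X ∣
  splitters⇒3≤∣X∣ {m} 1≤m m≤k X (x₀ , x₀∈X , s₀) (xₖ , xₖ∈X , sₖ) (x₁ , x₁∈X , s₁) (x₂ , x₂∈X , s₂) = pick (x₀ ≟ᶠ xₖ)
    where
    r : Fin (N k) → ℕ
    r x = toℕ x % 4
    x₁≢x₀ : x₁ ≢ x₀
    x₁≢x₀ e = SplitterB₁⇒¬SplitterA₀ 1≤m (r x₁) s₁ (subst (At SplitterA₀) (sym e) s₀)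
    x₁≢xₖ : x₁ ≢ xₖ
    x₁≢xₖ e = SplitterB₁⇒¬SplitterAₖ 1≤m m≤k (r x₁) s₁ (subst (At SplitterAₖ) (sym e) sₖ)
    x₁≢x₂ : x₁ ≢ x₂
    x₁≢x₂ e = SplitterB₁⇒¬SplitterB₂ (r x₁) s₁ (subst (At (SplitterB₂ m)) (sym e) s₂)
    pick : Dec (x₀ ≡ xₖ) → 3 ≤ ∣ X ∣
    pick (no x₀≢xₖ)  = 3≤∣p∣ x₁≢x₀ x₁≢xₖ x₀≢xₖ x₁∈X x₀∈X xₖ∈X
    pick (yes x₀≡xₖ) = 3≤∣p∣ x₁≢x₀ x₁≢x₂ x₀≢x₂ x₁∈X x₀∈X x₂∈X
      where
      x₀≢x₂ : x₀ ≢ x₂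
      x₀≢x₂ e = ¬SplitterA₀∧SplitterAₖ∧SplitterB₂ (r x₀) s₀ (subst (At SplitterAₖ) (sym x₀≡xₖ) sₖ)
                  (subst (At (SplitterB₂ m)) (sym e) s₂)

lemma3p11 : (k : ℕ) → 1 ≤ k → (m' : ℕ) → 1 ≤ m' → m' ≤ k →
    (S : Subset (N k)) → Circulant.IsCluster (N k) S (k + 3) (clusterA k m') →
    (X : Subset (N k)) → Circulant.Resolves (N k) X (k + 3) (clusterA k m') →
    3 ≤ ∣ X ∣
lemma3p11 k@(suc k′) _ m 1≤m m≤k _ _ X resolves = splitters⇒3≤∣X∣ 1≤m m≤k X
  (splitter∈X X resolves SplitterA₀ (λ r<4 _ → splitterA₀ r<4) zero (c+4*j<n {4} {0} (m≤m+n 4 2) z≤n) (pair∈A₀ k′ m))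
  (splitter∈X X resolves SplitterAₖ splitterAₖ (k ↑ʳ zero) (c+4*j<n {5} {k} (n≤1+n 5) k≤2*k) (pair∈Aₖ k m))
  (splitter∈X X resolves (SplitterB₁ m) (splitterB₁ m) (k ↑ʳ suc zero)
    (c+4*j<n {4} {k + m} (m≤m+n 4 2) k+m≤2*k) (pair∈B₁ k m))
  (splitter∈X X resolves (SplitterB₂ m) (splitterB₂ m) (k ↑ʳ suc (suc zero))
    (c+4*j<n {6} {k + m} ≤-refl k+m≤2*k) (pair∈B₂ k m))
  where
  open Splitting k
  k+m≤2*k : k + m ≤ 2 * k
  k+m≤2*k = ≤-trans (+-monoʳ-≤ k m≤k) (≤-reflexive (cong (k +_) (sym (+-identityʳ k))))
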